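{- Let $a=(1,0)$, $b=(0,1)$ be the standard generators of $\mathbb{Z}^2$ and let $D$ be a set of 2 or 3 elements of $\{a,b,a^{ -1},b^{ -1}\}$ (i.e. of the directions $(1,0),(0,1),(-1,0),(0,-1)$). Then the infinite snake problem in $\mathbb{Z}^2$ restricted to the directions in $D$ is decidable: there is an algorithm that, given a tileset graph $\Gamma$ for $(\mathbb{Z}^2,\{a,b\})$, decides whether there exists a bi-infinite $\Gamma$-snake $(\omega,\zeta)$ with $d\omega_i\in D$ for all $i\in\mathbb{Z}$.
   Context: A tileset graph for $(\mathbb{Z}^2,\{a,b\})$ is a finite multigraph $\Gamma=(A,B)$ with vertex set $A$ whose edges are triples $(x,x',s)$ with $x,x'\in A$ and $s\in\{a,b,a^{ -1},b^{ -1}\}$, such that $(x,x',s)\in B$ implies $(x',x,s^{ -1})\in B$. A bi-infinite $\Gamma$-snake is a pair $(\omega,\zeta)$ with $\omega:\mathbb{Z}\to\mathbb{Z}^2$ injective and $\zeta:\mathbb{Z}\to A$ such that for all $i$, $d\omega_i:=\omega(i+1)-\omega(i)\in\{a,b,a^{ -1},b^{ -1}\}$ and $(\zeta(i),\zeta(i+1),d\omega_i)\in B$. -}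

module Defs where

open import Data.Nat using (ℕ)
open import Data.Integer using (ℤ; +_; _+_; -_; 1ℤ)
open import Data.Fin using (Fin)
open import Data.Product using (Σ; _×_; _,_; ∃)
open import Data.List using (List)
open import Data.List.Membership.Propositional using (_∈_)
open import Relation.Binary.PropositionalEquality using (_≡_)
open import Function.Definitions using (Injective)

data Dir : Set where
  a b a⁻¹ b⁻¹ : Dir

_⁻¹ᵈ : Dir → Dir
a ⁻¹ᵈ = a⁻¹
b ⁻¹ᵈ = b⁻¹
a⁻¹ ⁻¹ᵈ = a
b⁻¹ ⁻¹ᵈ = b

ℤ² : Set
ℤ² = ℤ × ℤ

vec : Dir → ℤ²
vec a = (1ℤ , + 0)
vec b = (+ 0 , 1ℤ)
vec a⁻¹ = (- 1ℤ , + 0)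
vec b⁻¹ = (+ 0 , - 1ℤ)

_⊕_ : ℤ² → ℤ² → ℤ²
(x , y) ⊕ (x' , y') = (x + x' , y + y')

-- A tileset graph: finite vertex set A = Fin size, a finite multiset of
-- labelled edges (a list, duplicates allowed), closed under reversal.
record TilesetGraph : Set where
  field
    size  : ℕ
    edges : List (Fin size × Fin size × Dir)
    symm  : ∀ {x x' s} → (x , x' , s) ∈ edges → (x' , x , s ⁻¹ᵈ) ∈ edges

open TilesetGraph public

record Snake (Γ : TilesetGraph) (D : List Dir) : Set where
  field
    ω     : ℤ → ℤ²
    ζ     : ℤ → Fin (size Γ)
    ω-inj : Injective _≡_ _≡_ ω
    dω    : ℤ → Dir
    step  : ∀ i → ω (i + 1ℤ) ≡ ω i ⊕ vec (dω i)
    edge  : ∀ i → (ζ i , ζ (i + 1ℤ) , dω i) ∈ edges Γ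
    inD   : ∀ i → dω i ∈ D

-- Choose a direction m missing from D. A walk that never steps in direction m and
-- never immediately reverses a step cannot revisit a point: after rotating so that m
-- points down, its height never decreases, and while the height stays constant it
-- moves monotonically sideways. So a snake with steps in D is the same thing as a
-- bi-infinite path in the finite graph whose states are pairs (tile, next step), with
-- transitions given by the Γ-edges labelled in D that are not followed by their
-- reverse; injectivity of ω comes for free. Such a path exists iff the graph has a
-- walk as long as its number of states: that walk repeats a state, and the cycle in
-- between can be traversed forever in both directions.
module Submission where

open import Defs
open import Data.Empty using (⊥; ⊥-elim)
open import Data.Fin using (Fin; toℕ) renaming (_≟_ to _≟ᶠ_)
open import Data.Fin.Properties using (any?; ¬∀⟶∃¬; pigeonhole; injective⇒≤; *↔×; toℕ<n; inj⇒≟)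
open import Data.Integer using (ℤ; +_; +[1+_]; -[1+_]; _+_; _-_; -_; 1ℤ; _<_; _≤_)
open import Data.Integer.Properties
  using (+-assoc; +-identityʳ; +-comm; neg-distrib-+; <-trans; ≤-<-trans; <⇒≤; <⇒≢; ≤-reflexive;
         suc[i]≤j⇒i<j; i≤pred[j]⇒i<j; i-j≡0⇒i≡j)
open import Data.Integer.Tactic.RingSolver using (solve-∀)
open import Data.List using (List; length; lookup)
open import Data.List.Membership.Propositional using (_∈_; _∉_)
open import Data.List.Relation.Unary.Any using (index) renaming (any? to any∈?)
open import Data.List.Relation.Unary.Any.Properties using (lookup-index)
open import Data.List.Relation.Unary.Unique.Propositional using (Unique)
open import Data.Nat as ℕ using (ℕ; zero; suc; z≤n; s≤s)
open import Data.Nat.GeneralisedArithmetic using (fold)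
import Data.Nat.Properties as ℕ
open import Data.Product using (Σ; ∃; _×_; _,_; proj₁; proj₂)
open import Data.Product.Function.NonDependent.Propositional using (_×-↔_)
open import Data.Product.Properties using (≡-dec)
open import Data.Sum using (_⊎_; inj₁; inj₂; [_,_])
open import Function using (_∘_; Inverse; _↔_; mk↔ₛ′)
open import Function.Construct.Composition using (_↔-∘_)
open import Function.Bundles using (Injection)
open import Function.Definitions using (Injective)
open import Function.Properties.Inverse using (↔-sym; ↔-refl; ↔⇒↣)
open import Relation.Binary.Definitions using (DecidableEquality)
open import Relation.Binary.PropositionalEquality
  using (_≡_; _≢_; refl; sym; trans; cong; cong₂; subst; module ≡-Reasoning)
open import Relation.Nullary using (Dec; yes; no; ¬_)
open import Relation.Nullary.Decidable using (map′; _×-dec_; ¬?)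

module Enumeration {A : Set} {n : ℕ} (enum : Fin n ↔ A) where
  open Inverse enum

  ∃? : {P : A → Set} → (∀ x → Dec (P x)) → Dec (∃ P)
  ∃? {P} P? = map′ (λ (i , p) → to i , p)
                   (λ (x , p) → from x , subst P (sym (strictlyInverseˡ x)) p)
                   (any? (P? ∘ to))

  from-injective : Injective _≡_ _≡_ from
  from-injective = Injection.injective (↔⇒↣ (↔-sym enum))

  enumeration-length : {xs : List A} → (∀ x → x ∈ xs) → n ℕ.≤ length xs
  enumeration-length {xs} all∈ = injective⇒≤ position-injective
    where
    position : Fin n → Fin (length xs)
    position i = index (all∈ (to i))

    position-injective : Injective _≡_ _≡_ position
    position-injective {i} {j} eq = Injection.injective (↔⇒↣ enum) (begin
      to i                       ≡⟨ lookup-index (all∈ (to i)) ⟩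
      lookup xs (position i)     ≡⟨ cong (lookup xs) eq ⟩
      lookup xs (position j)     ≡⟨ lookup-index (all∈ (to j)) ⟨
      to j                       ∎)
      where open ≡-Reasoning

  ∃∉-short-list : (xs : List A) → length xs ℕ.< n → ∃ λ x → x ∉ xs
  ∃∉-short-list xs short =
    let i , to-i∉ = ¬∀⟶∃¬ n (λ i → to i ∈ xs) (λ i → any∈? (to i ≟_) xs) not-all
    in to i , to-i∉
    where
    _≟_ : DecidableEquality A
    _≟_ = inj⇒≟ (↔⇒↣ (↔-sym enum))

    not-all : ¬ (∀ i → to i ∈ xs)
    not-all all∈ = ℕ.<⇒≱ short
      (enumeration-length λ x → subst (_∈ xs) (strictlyInverseˡ x) (all∈ (from x)))

BiInfinitePath : {V : Set} → (V → V → Set) → Set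
BiInfinitePath {V} R = Σ (ℤ → V) λ p → ∀ i → R (p i) (p (i + 1ℤ))

+[n]+1≡+[1+n] : ∀ n → + n + 1ℤ ≡ + suc n
+[n]+1≡+[1+n] n = cong +_ (ℕ.+-comm n 1)

unroll : {V P : Set} {R : V → V → Set} (label : P → V) (next prev : P → P) →
         (∀ q → R (label q) (label (next q))) → (∀ q → R (label (prev q)) (label q)) →
         P → BiInfinitePath R
unroll {R = R} label next prev R-next R-prev q₀ = path , adjacent
  where
  path : ℤ → _
  path (+ n)    = label (fold q₀ next n)
  path -[1+ n ] = label (fold (prev q₀) prev n)

  adjacent : ∀ i → R (path i) (path (i + 1ℤ))
  adjacent (+ n)        = subst (λ j → R (path (+ n)) (path j)) (sym (+[n]+1≡+[1+n] n)) (R-next _)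
  adjacent -[1+ zero ]  = R-prev q₀
  adjacent -[1+ suc n ] = R-prev _

module BiInfinitePaths {V : Set} {K : ℕ} (enum : Fin K ↔ V)
                       (R : V → V → Set) (R? : ∀ x y → Dec (R x y)) where
  open Enumeration enum

  data Walk : ℕ → V → Set where
    []  : ∀ {x} → Walk zero x
    _∷_ : ∀ {n x y} → R x y → Walk n y → Walk (suc n) x

  walk? : ∀ n x → Dec (Walk n x)
  walk? zero    x = yes []
  walk? (suc n) x = map′ (λ (_ , r , w) → r ∷ w) (λ { (r ∷ w) → _ , r , w })
                         (∃? λ y → R? x y ×-dec walk? n y)

  biPath⇒walk : ((p , _) : BiInfinitePath R) → ∀ n k → Walk n (p (+ k))
  biPath⇒walk (p , adj) zero    k = []
  biPath⇒walk (p , adj) (suc n) k =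
    subst (λ j → R (p (+ k)) (p j)) (+[n]+1≡+[1+n] k) (adj (+ k)) ∷ biPath⇒walk (p , adj) n (suc k)

  -- Beyond the length of the walk, vertex repeats its last vertex (a junk value).
  vertex : ∀ {n x} → Walk n x → ℕ → V
  vertex {x = x} _       zero    = x
  vertex {x = x} []      (suc t) = x
  vertex         (_ ∷ w) (suc t) = vertex w t

  vertex-step : ∀ {n x} (w : Walk n x) {t} → t ℕ.< n → R (vertex w t) (vertex w (suc t))
  vertex-step (r ∷ w) {zero}  _          = r
  vertex-step (r ∷ w) {suc t} (s≤s t<n) = vertex-step w t<n

  record Loop : Set where
    field
      len    : ℕ
      at     : ℕ → V
      step   : ∀ t → t ℕ.≤ len → R (at t) (at (suc t))
      closed : at (suc len) ≡ at 0

  loop⇒biPath : Loop → BiInfinitePath R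
  loop⇒biPath L = unroll {R = R} (at ∘ proj₁) next prev R-next R-prev (0 , z≤n)
    where
    open Loop L

    Position : Set
    Position = Σ ℕ (ℕ._≤ len)

    next : Position → Position
    next (t , _) with suc t ℕ.≤? len
    ... | yes t<len = suc t , t<len
    ... | no  _     = 0 , z≤n

    R-next : ∀ q → R (at (proj₁ q)) (at (proj₁ (next q)))
    R-next (t , t≤len) with suc t ℕ.≤? len
    ... | yes _     = step t t≤len
    ... | no  t≮len = subst (R (at t)) closed
      (subst (λ u → R (at t) (at (suc u))) (ℕ.≤-antisym t≤len (ℕ.≮⇒≥ t≮len)) (step t t≤len))

    prev : Position → Position
    prev (zero  , _)       = len , ℕ.≤-refl
    prev (suc t , t<len)   = t , ℕ.<⇒≤ t<len

    R-prev : ∀ q → R (at (proj₁ (prev q))) (at (proj₁ q))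
    R-prev (zero  , _)       = subst (R (at len)) closed (step len ℕ.≤-refl)
    R-prev (suc t , t<len)   = step t (ℕ.<⇒≤ t<len)

  repeat⇒loop : ∀ {n x} (w : Walk n x) {i j} → i ℕ.< j → j ℕ.≤ n → vertex w i ≡ vertex w j → Loop
  repeat⇒loop {n} w {i} {j} i<j j≤n repeat = record
    { len = len ; at = at ; step = step ; closed = closed }
    where
    len : ℕ
    len = proj₁ (ℕ.m≤n⇒∃[o]m+o≡n i<j)

    j≡i+1+len : suc i ℕ.+ len ≡ j
    j≡i+1+len = proj₂ (ℕ.m≤n⇒∃[o]m+o≡n i<j)

    at : ℕ → V
    at t = vertex w (i ℕ.+ t)

    step : ∀ t → t ℕ.≤ len → R (at t) (at (suc t))
    step t t≤len = subst (λ u → R (at t) (vertex w u)) (sym (ℕ.+-suc i t)) (vertex-step w i+t<n)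
      where
      i+t<n : i ℕ.+ t ℕ.< n
      i+t<n = ℕ.≤-trans (s≤s (ℕ.+-monoʳ-≤ i t≤len)) (subst (ℕ._≤ n) (sym j≡i+1+len) j≤n)

    closed : at (suc len) ≡ at 0
    closed = begin
      vertex w (i ℕ.+ suc len)   ≡⟨ cong (vertex w) (trans (ℕ.+-suc i len) j≡i+1+len) ⟩
      vertex w j                 ≡⟨ repeat ⟨
      vertex w i                 ≡⟨ cong (vertex w) (ℕ.+-identityʳ i) ⟨
      vertex w (i ℕ.+ 0)         ∎
      where open ≡-Reasoning

  long-walk⇒loop : ∀ {x} → Walk K x → Loop
  long-walk⇒loop w
    with i , j , i<j , same ← pigeonhole (ℕ.n<1+n K) (Inverse.from enum ∘ vertex w ∘ toℕ)
    = repeat⇒loop w i<j (ℕ.≤-pred (toℕ<n j)) (from-injective same)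

  biPath? : Dec (BiInfinitePath R)
  biPath? with ∃? (walk? K)
  ... | yes (_ , w) = yes (loop⇒biPath (long-walk⇒loop w))
  ... | no  ¬w      = no λ P → ¬w (_ , biPath⇒walk P K 0)

Fin4↔Dir : Fin 4 ↔ Dir
Fin4↔Dir = mk↔ₛ′ to from to∘from from∘to
  where
  to : Fin 4 → Dir
  to Fin.zero                        = a
  to (Fin.suc Fin.zero)              = b
  to (Fin.suc (Fin.suc Fin.zero))    = a⁻¹
  to (Fin.suc (Fin.suc (Fin.suc _))) = b⁻¹

  from : Dir → Fin 4
  from a   = Fin.zero
  from b   = Fin.suc Fin.zero
  from a⁻¹ = Fin.suc (Fin.suc Fin.zero)
  from b⁻¹ = Fin.suc (Fin.suc (Fin.suc Fin.zero))

  to∘from : ∀ d → to (from d) ≡ d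
  to∘from a   = refl
  to∘from b   = refl
  to∘from a⁻¹ = refl
  to∘from b⁻¹ = refl

  from∘to : ∀ i → from (to i) ≡ i
  from∘to Fin.zero                               = refl
  from∘to (Fin.suc Fin.zero)                     = refl
  from∘to (Fin.suc (Fin.suc Fin.zero))           = refl
  from∘to (Fin.suc (Fin.suc (Fin.suc Fin.zero))) = refl

_≟ᵈ_ : DecidableEquality Dir
_≟ᵈ_ = inj⇒≟ (↔⇒↣ (↔-sym Fin4↔Dir))

missing-direction : (D : List Dir) → length D ℕ.< 4 → ∃ λ m → m ∉ D
missing-direction = Enumeration.∃∉-short-list Fin4↔Dir

0ℤ² : ℤ²
0ℤ² = + 0 , + 0

⊕-assoc : ∀ p q r → (p ⊕ q) ⊕ r ≡ p ⊕ (q ⊕ r)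
⊕-assoc (x , y) (x' , y') (x'' , y'') = cong₂ _,_ (+-assoc x x' x'') (+-assoc y y' y'')

⊕-identityʳ : ∀ p → p ⊕ 0ℤ² ≡ p
⊕-identityʳ (x , y) = cong₂ _,_ (+-identityʳ x) (+-identityʳ y)

⊕-cancelʳ : ∀ p q q' → q ⊕ q' ≡ 0ℤ² → (p ⊕ q) ⊕ q' ≡ p
⊕-cancelʳ p q q' q⊕q'≡0 = begin
  (p ⊕ q) ⊕ q'   ≡⟨ ⊕-assoc p q q' ⟩
  p ⊕ (q ⊕ q')   ≡⟨ cong (p ⊕_) q⊕q'≡0 ⟩
  p ⊕ 0ℤ²        ≡⟨ ⊕-identityʳ p ⟩
  p              ∎
  where open ≡-Reasoning

vec-inverseʳ : ∀ d → vec d ⊕ vec (d ⁻¹ᵈ) ≡ 0ℤ²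
vec-inverseʳ a   = refl
vec-inverseʳ b   = refl
vec-inverseʳ a⁻¹ = refl
vec-inverseʳ b⁻¹ = refl

vec-inverseˡ : ∀ d → vec (d ⁻¹ᵈ) ⊕ vec d ≡ 0ℤ²
vec-inverseˡ a   = refl
vec-inverseˡ b   = refl
vec-inverseˡ a⁻¹ = refl
vec-inverseˡ b⁻¹ = refl

⊕-vec-cancelʳ : ∀ p d → (p ⊕ vec d) ⊕ vec (d ⁻¹ᵈ) ≡ p
⊕-vec-cancelʳ p d = ⊕-cancelʳ p (vec d) (vec (d ⁻¹ᵈ)) (vec-inverseʳ d)

⊕-vec-cancelˡ : ∀ p d → (p ⊕ vec (d ⁻¹ᵈ)) ⊕ vec d ≡ p
⊕-vec-cancelˡ p d = ⊕-cancelʳ p (vec (d ⁻¹ᵈ)) (vec d) (vec-inverseˡ d)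

rotate : ℤ² → ℤ²
rotate (x , y) = - y , x

rotateᵈ : Dir → Dir
rotateᵈ a   = b
rotateᵈ b   = a⁻¹
rotateᵈ a⁻¹ = b⁻¹
rotateᵈ b⁻¹ = a

rotate-⊕ : ∀ p q → rotate (p ⊕ q) ≡ rotate p ⊕ rotate q
rotate-⊕ (x , y) (x' , y') = cong (_, x + x') (neg-distrib-+ y y')

rotate-vec : ∀ d → rotate (vec d) ≡ vec (rotateᵈ d)
rotate-vec a   = refl
rotate-vec b   = refl
rotate-vec a⁻¹ = refl
rotate-vec b⁻¹ = refl

rotateᵈ-⁻¹ : ∀ d → rotateᵈ (d ⁻¹ᵈ) ≡ rotateᵈ d ⁻¹ᵈ
rotateᵈ-⁻¹ a   = refl
rotateᵈ-⁻¹ b   = refl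
rotateᵈ-⁻¹ a⁻¹ = refl
rotateᵈ-⁻¹ b⁻¹ = refl

rotateᵈ⁴ : ∀ d → rotateᵈ (rotateᵈ (rotateᵈ (rotateᵈ d))) ≡ d
rotateᵈ⁴ a   = refl
rotateᵈ⁴ b   = refl
rotateᵈ⁴ a⁻¹ = refl
rotateᵈ⁴ b⁻¹ = refl

rotateᵈ-injective : Injective _≡_ _≡_ rotateᵈ
rotateᵈ-injective {d} {e} eq =
  trans (sym (rotateᵈ⁴ d)) (trans (cong (rotateᵈ ∘ rotateᵈ ∘ rotateᵈ) eq) (rotateᵈ⁴ e))

record Trail (m : Dir) : Set where
  field
    pos          : ℕ → ℤ²
    dir          : ℕ → Dir
    step         : ∀ n → pos (suc n) ≡ pos n ⊕ vec (dir n)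
    avoids       : ∀ n → dir n ≢ m
    no-backtrack : ∀ n → dir (suc n) ≢ dir n ⁻¹ᵈ

rotate-trail : ∀ {m} → Trail m → Trail (rotateᵈ m)
rotate-trail T = record
  { pos          = rotate ∘ pos
  ; dir          = rotateᵈ ∘ dir
  ; step         = λ n → trans (cong rotate (step n))
                     (trans (rotate-⊕ (pos n) _) (cong (rotate (pos n) ⊕_) (rotate-vec (dir n))))
  ; avoids       = λ n → avoids n ∘ rotateᵈ-injective
  ; no-backtrack = λ n eq → no-backtrack n (rotateᵈ-injective (trans eq (sym (rotateᵈ-⁻¹ (dir n)))))
  }
  where open Trail T

i<i+1 : ∀ i → i < i + 1ℤ
i<i+1 i = suc[i]≤j⇒i<j (≤-reflexive (+-comm 1ℤ i))

i-1<i : ∀ i → i - 1ℤ < i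
i-1<i i = i≤pred[j]⇒i<j (≤-reflexive (+-comm i (- 1ℤ)))

Ahead : Dir → ℤ → ℤ → Set
Ahead a   x₀ x = x₀ < x
Ahead a⁻¹ x₀ x = x < x₀
Ahead b   _  _ = ⊥
Ahead b⁻¹ _  _ = ⊥

-- Invariant of a trail avoiding b⁻¹ from p₀: d is its last step and p its current point.
Beyond : ℤ² → Dir → ℤ² → Set
Beyond (x₀ , y₀) d (x , y) = y₀ < y ⊎ (y ≡ y₀ × Ahead d x₀ x)

beyond-≢ : ∀ {p₀ d p} → Beyond p₀ d p → p ≢ p₀
beyond-≢ {d = a}   (inj₂ (_ , x₀<x)) refl = <⇒≢ x₀<x refl
beyond-≢ {d = a⁻¹} (inj₂ (_ , x<x₀)) refl = <⇒≢ x<x₀ refl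
beyond-≢           (inj₁ y₀<y)       refl = <⇒≢ y₀<y refl

beyond-height : ∀ {x₀ y₀ d x y} → Beyond (x₀ , y₀) d (x , y) → y₀ ≤ y
beyond-height (inj₁ y₀<y)      = <⇒≤ y₀<y
beyond-height (inj₂ (y≡y₀ , _)) = ≤-reflexive (sym y≡y₀)

beyond-start : ∀ x₀ y₀ d → d ≢ b⁻¹ → Beyond (x₀ , y₀) d ((x₀ , y₀) ⊕ vec d)
beyond-start x₀ y₀ a   _ = inj₂ (+-identityʳ y₀ , i<i+1 x₀)
beyond-start x₀ y₀ b   _ = inj₁ (i<i+1 y₀)
beyond-start x₀ y₀ a⁻¹ _ = inj₂ (+-identityʳ y₀ , i-1<i x₀)
beyond-start x₀ y₀ b⁻¹ d≢b⁻¹ = ⊥-elim (d≢b⁻¹ refl)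

beyond-step : ∀ {x₀ y₀ d x y} e → Beyond (x₀ , y₀) d (x , y) → e ≢ b⁻¹ → e ≢ d ⁻¹ᵈ →
              Beyond (x₀ , y₀) e ((x , y) ⊕ vec e)
beyond-step {y = y} b B _ _ = inj₁ (≤-<-trans (beyond-height B) (i<i+1 y))
beyond-step {y = y} a (inj₁ y₀<y) _ _ = inj₁ (subst (_ <_) (sym (+-identityʳ y)) y₀<y)
beyond-step {d = a} {x} {y} a (inj₂ (y≡y₀ , x₀<x)) _ _ =
  inj₂ (trans (+-identityʳ y) y≡y₀ , <-trans x₀<x (i<i+1 x))
beyond-step {d = a⁻¹} a (inj₂ _) _ a≢a = ⊥-elim (a≢a refl)
beyond-step {y = y} a⁻¹ (inj₁ y₀<y) _ _ = inj₁ (subst (_ <_) (sym (+-identityʳ y)) y₀<y)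
beyond-step {d = a⁻¹} {x} {y} a⁻¹ (inj₂ (y≡y₀ , x<x₀)) _ _ =
  inj₂ (trans (+-identityʳ y) y≡y₀ , <-trans (i-1<i x) x<x₀)
beyond-step {d = a} a⁻¹ (inj₂ _) _ a⁻¹≢a⁻¹ = ⊥-elim (a⁻¹≢a⁻¹ refl)
beyond-step b⁻¹ _ b⁻¹≢b⁻¹ _ = ⊥-elim (b⁻¹≢b⁻¹ refl)

NeverReturns : Dir → Set
NeverReturns m = (T : Trail m) → ∀ n → Trail.pos T (suc n) ≢ Trail.pos T 0

never-returns-upward : NeverReturns b⁻¹
never-returns-upward T n = beyond-≢ (beyond n)
  where
  open Trail T
  beyond : ∀ n → Beyond (pos 0) (dir n) (pos (suc n))
  beyond zero    = subst (Beyond (pos 0) (dir 0)) (sym (step 0))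
                     (beyond-start _ _ (dir 0) (avoids 0))
  beyond (suc n) = subst (Beyond (pos 0) (dir (suc n))) (sym (step (suc n)))
                     (beyond-step (dir (suc n)) (beyond n) (avoids (suc n)) (no-backtrack n))

never-returns-rotated : ∀ {m} → NeverReturns (rotateᵈ m) → NeverReturns m
never-returns-rotated never T n = never (rotate-trail T) n ∘ cong rotate

never-returns : ∀ m → NeverReturns m
never-returns b⁻¹ = never-returns-upward
never-returns a⁻¹ = never-returns-rotated never-returns-upward
never-returns b   = never-returns-rotated (never-returns-rotated never-returns-upward)
never-returns a   = never-returns-rotated (never-returns-rotated (never-returns-rotated never-returns-upward))

+-minus-cancel : ∀ i j → i + (j - i) ≡ j
+-minus-cancel = solve-∀

neg-minus : ∀ i j → - (j - i) ≡ i - j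
neg-minus = solve-∀

i+n+1≡i+[1+n] : ∀ i k → i + + k + 1ℤ ≡ i + + suc k
i+n+1≡i+[1+n] i k = trans (+-assoc i (+ k) 1ℤ) (cong (λ j → i + j) (+[n]+1≡+[1+n] k))

module NonBacktracking {m : Dir} (ω : ℤ → ℤ²) (d : ℤ → Dir)
                       (step : ∀ i → ω (i + 1ℤ) ≡ ω i ⊕ vec (d i))
                       (avoids : ∀ i → d i ≢ m)
                       (no-backtrack : ∀ i → d (i + 1ℤ) ≢ d i ⁻¹ᵈ) where

  trail-from : ℤ → Trail m
  trail-from i = record
    { pos          = λ k → ω (i + + k)
    ; dir          = λ k → d (i + + k)
    ; step         = λ k → trans (cong ω (sym (i+n+1≡i+[1+n] i k))) (step (i + + k))
    ; avoids       = λ k → avoids (i + + k)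
    ; no-backtrack = λ k → subst (λ j → d j ≢ d (i + + k) ⁻¹ᵈ) (i+n+1≡i+[1+n] i k)
                                 (no-backtrack (i + + k))
    }

  never-revisits : ∀ i k → ω (i + +[1+ k ]) ≢ ω i
  never-revisits i k eq = never-returns m (trail-from i) k (trans eq (cong ω (sym (+-identityʳ i))))

  injective : Injective _≡_ _≡_ ω
  injective {i} {j} ωi≡ωj with j - i in gap
  ... | + zero   = sym (i-j≡0⇒i≡j j i gap)
  ... | +[1+ k ] = ⊥-elim (never-revisits i k (begin
    ω (i + +[1+ k ])   ≡⟨ cong (λ g → ω (i + g)) gap ⟨
    ω (i + (j - i))    ≡⟨ cong ω (+-minus-cancel i j) ⟩
    ω j                ≡⟨ ωi≡ωj ⟨
    ω i                ∎))
    where open ≡-Reasoning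
  ... | -[1+ k ] = ⊥-elim (never-revisits j k (begin
    ω (j + +[1+ k ])   ≡⟨ cong (λ g → ω (j + g)) (trans (sym (neg-minus i j)) (cong -_ gap)) ⟨
    ω (j + (i - j))    ≡⟨ cong ω (+-minus-cancel j i) ⟩
    ω i                ≡⟨ ωi≡ωj ⟩
    ω j                ∎))
    where open ≡-Reasoning

trajectory : (ℤ → Dir) → ℤ → ℤ²
trajectory d (+ zero)      = 0ℤ²
trajectory d +[1+ n ]      = trajectory d (+ n) ⊕ vec (d (+ n))
trajectory d -[1+ zero ]   = 0ℤ² ⊕ vec (d -[1+ zero ] ⁻¹ᵈ)
trajectory d -[1+ suc n ]  = trajectory d -[1+ n ] ⊕ vec (d -[1+ suc n ] ⁻¹ᵈ)

trajectory-step : ∀ d i → trajectory d (i + 1ℤ) ≡ trajectory d i ⊕ vec (d i)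
trajectory-step d (+ n)          = cong (trajectory d) (+[n]+1≡+[1+n] n)
trajectory-step d -[1+ zero ]    = sym (⊕-vec-cancelˡ 0ℤ² (d -[1+ zero ]))
trajectory-step d -[1+ suc n ]   = sym (⊕-vec-cancelˡ (trajectory d -[1+ n ]) (d -[1+ suc n ]))

module Snakes (Γ : TilesetGraph) (D : List Dir) where

  -- A state pairs a tile with the direction of the step leaving it.
  State : Set
  State = Fin (size Γ) × Dir

  Move : State → State → Set
  Move (x , d) (y , e) = (x , y , d) ∈ edges Γ × d ∈ D × e ≢ d ⁻¹ᵈ

  move? : ∀ s t → Dec (Move s t)
  move? (x , d) (y , e) =
    any∈? ((x , y , d) ≟ₑ_) (edges Γ) ×-dec any∈? (d ≟ᵈ_) D ×-dec ¬? (e ≟ᵈ (d ⁻¹ᵈ))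
    where
    _≟ₑ_ : DecidableEquality (Fin (size Γ) × Fin (size Γ) × Dir)
    _≟ₑ_ = ≡-dec _≟ᶠ_ (≡-dec _≟ᶠ_ _≟ᵈ_)

  enumeration : Fin (size Γ ℕ.* 4) ↔ State
  enumeration = (↔-refl ×-↔ Fin4↔Dir) ↔-∘ *↔×

  snake⇒biPath : Snake Γ D → BiInfinitePath Move
  snake⇒biPath S = (λ i → ζ i , dω i) , λ i → edge i , inD i , no-backtrack i
    where
    open Snake S

    no-backtrack : ∀ i → dω (i + 1ℤ) ≢ dω i ⁻¹ᵈ
    no-backtrack i reversal = <⇒≢ (<-trans (i<i+1 i) (i<i+1 (i + 1ℤ))) (sym (ω-inj returns))
      where
      open ≡-Reasoning
      returns : ω (i + 1ℤ + 1ℤ) ≡ ω i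
      returns = begin
        ω (i + 1ℤ + 1ℤ)                           ≡⟨ step (i + 1ℤ) ⟩
        ω (i + 1ℤ) ⊕ vec (dω (i + 1ℤ))            ≡⟨ cong₂ (λ p e → p ⊕ vec e) (step i) reversal ⟩
        (ω i ⊕ vec (dω i)) ⊕ vec (dω i ⁻¹ᵈ)       ≡⟨ ⊕-vec-cancelʳ (ω i) (dω i) ⟩
        ω i                                       ∎

  biPath⇒snake : ∀ {m} → m ∉ D → BiInfinitePath Move → Snake Γ D
  biPath⇒snake {m} m∉D (p , move) = record
    { ω     = trajectory d
    ; ζ     = proj₁ ∘ p
    ; ω-inj = NonBacktracking.injective (trajectory d) d (trajectory-step d) avoids
                (proj₂ ∘ proj₂ ∘ move)
    ; dω    = d
    ; step  = trajectory-step d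
    ; edge  = proj₁ ∘ move
    ; inD   = proj₁ ∘ proj₂ ∘ move
    }
    where
    d : ℤ → Dir
    d = proj₂ ∘ p

    avoids : ∀ i → d i ≢ m
    avoids i d≡m = m∉D (subst (_∈ D) d≡m (proj₁ (proj₂ (move i))))

  snake? : ∀ {m} → m ∉ D → Dec (Snake Γ D)
  snake? m∉D = map′ (biPath⇒snake m∉D) snake⇒biPath
                    (BiInfinitePaths.biPath? enumeration Move move?)

theorem2 : (D : List Dir) → Unique D → (length D ≡ 2 ⊎ length D ≡ 3) →
           (Γ : TilesetGraph) → Dec (Snake Γ D)
theorem2 D _ |D|≡2or3 Γ = Snakes.snake? Γ D (proj₂ (missing-direction D |D|<4))
  where
  |D|<4 : length D ℕ.< 4
  |D|<4 = [ (λ |D|≡2 → ℕ.m≤n⇒m≤1+n (ℕ.≤-reflexive (cong suc |D|≡2)))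
          , (λ |D|≡3 → ℕ.≤-reflexive (cong suc |D|≡3)) ] |D|≡2or3
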